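{- Let $r$ be an integer with $r\ge\max\{\rho(x):x\in G,\ \|x\|\le1\}$. Let $z,z'\in G$ be such that $B_r+z$ and $B_r+z'$ are vertex-disjoint, and let $\phi$ be an injective map from $V(B_r+z)\cup V(B_r+z')$ to $G$ that maps every edge of $B_r+z$ and of $B_r+z'$ to an edge of $\Gamma$. Then $(S_1+\phi(z))\cap(S_1+\phi(z'))=\varnothing$.
   Context: Let $G$ be a free abelian group of finite rank $k\ge1$, identified with $\mathbb{Z}^k\subset\mathbb{R}^k$, and $\mathcal{A}\subset G$ a finite generating set with $\mathcal{A}=-\mathcal{A}$, $0\notin\mathcal{A}$. $\Gamma=\mathrm{Cay}(G,\mathcal{A})$ has vertex set $G$ and edges $\{x,x+a\}$, $a\in\mathcal{A}$. $\rho(x)$ is the length of a shortest path in $\Gamma$ from $0$ to $x$; $B_r$ is the subgraph of $\Gamma$ induced by $\{x:\rho(x)\le r\}$, and $B_r+z$ its translate by $z$. An element $x\in\mathcal{A}$ is primary if $\rho(tx)=t$ and the shortest path from $0$ to $tx$ is unique for all integers $t\ge0$; the primary elements span $\mathbb{R}^k$. Fix a basis $\mathcal{B}=\{b_1,\dots,b_k\}$ of $\mathbb{R}^k$ consisting of primary elements such that every primary element has all coordinates with respect to $\mathcal{B}$ in $[-1,1]$. All coordinates are taken with respect to $\mathcal{B}$: $\|x\|$ is the $\ell_\infty$-norm of the coordinate vector of $x$ w.r.t. $\mathcal{B}$, and $S_1=\{\sum_i t_ib_i: t_i\in[-1,1]\}$ is the unit cube in these coordinates.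
   Formalization: A common point of the cubes $S_1+\phi(z)$ and $S_1+\phi(z')$ is ruled out only among points with rational coordinates, and the cube coefficients $t_i$ are rational rather than real. -}

module Defs where

open import Data.Nat as ℕ using (ℕ; zero; suc; _≤_)
open import Data.Integer as ℤ using (ℤ; +_)
open import Data.Rational as ℚ using (ℚ; 0ℚ; 1ℚ)
open import Data.Fin using (Fin; zero; suc)
open import Data.Vec as V using (Vec)
open import Data.List as L using (List)
open import Data.List.Membership.Propositional using (_∈_)
open import Data.List.Relation.Unary.All using (All)
open import Data.Product using (Σ; ∃; _×_; proj₁)
open import Relation.Binary.PropositionalEquality using (_≡_)
open import Relation.Nullary using (¬_)

-- G = ℤ^k, elements are vectors of integers
Pt : ℕ → Set
Pt k = Vec ℤ k

0v : ∀ {k} → Pt k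
0v = V.replicate _ (+ 0)

_⊕_ : ∀ {k} → Pt k → Pt k → Pt k
_⊕_ = V.zipWith ℤ._+_

⊖_ : ∀ {k} → Pt k → Pt k
⊖_ = V.map (λ c → ℤ.- c)

_⊝_ : ∀ {k} → Pt k → Pt k → Pt k
x ⊝ y = x ⊕ (⊖ y)

_·_ : ∀ {k} → ℕ → Pt k → Pt k
t · x = V.map (λ c → + t ℤ.* c) x

sumV : ∀ {k} → List (Pt k) → Pt k
sumV = L.foldr _⊕_ 0v

-- A walk in Cay(G,A) from 0 to x of length n, given by its sequence of
-- generator steps (a walk from 0 is determined by its steps and vice versa)
Walk : ∀ {k} → List (Pt k) → Pt k → ℕ → Set
Walk {k} A x n = Σ (List (Pt k)) λ l → All (_∈ A) l × L.length l ≡ n × sumV l ≡ x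

ρ≡ : ∀ {k} → List (Pt k) → Pt k → ℕ → Set
ρ≡ A x n = Walk A x n × (∀ m → Walk A x m → n ≤ m)

ρ≤ : ∀ {k} → List (Pt k) → Pt k → ℕ → Set
ρ≤ A x r = ∃ λ n → n ≤ r × Walk A x n

record GenSet (k : ℕ) : Set where
  field
    A    : List (Pt k)
    symm : ∀ {a} → a ∈ A → (⊖ a) ∈ A
    no0  : ¬ (0v ∈ A)
    gen  : ∀ x → ∃ λ n → Walk A x n

Primary : ∀ {k} → List (Pt k) → Pt k → Set
Primary A x = x ∈ A × (∀ t → ρ≡ A (t · x) t
                         × ((w w' : Walk A (t · x) t) → proj₁ w ≡ proj₁ w'))

InBall : ∀ {k} → List (Pt k) → ℕ → Pt k → Pt k → Set
InBall A r z v = ρ≤ A (v ⊝ z) r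

toℚ : ∀ {k} → Pt k → Vec ℚ k
toℚ = V.map (λ c → c ℚ./ 1)

Σℚ : ∀ {n} → (Fin n → ℚ) → ℚ
Σℚ {zero}  f = 0ℚ
Σℚ {suc n} f = f zero ℚ.+ Σℚ (λ i → f (suc i))

lincomb : ∀ {k} → (Fin k → ℚ) → (Fin k → Pt k) → Vec ℚ k
lincomb t b = V.tabulate λ j → Σℚ λ i → t i ℚ.* V.lookup (toℚ (b i)) j

_⊕ℚ_ : ∀ {k} → Vec ℚ k → Vec ℚ k → Vec ℚ k
_⊕ℚ_ = V.zipWith ℚ._+_

IsBasis : ∀ {k} → (Fin k → Pt k) → Set
IsBasis {k} b = (∀ c → lincomb c b ≡ V.replicate k 0ℚ → ∀ i → c i ≡ 0ℚ)
              × (∀ p → ∃ λ c → lincomb c b ≡ p)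

InUnitCoords : ∀ {k} → (Fin k → ℚ) → Set
InUnitCoords t = ∀ i → (ℚ.- 1ℚ) ℚ.≤ t i × t i ℚ.≤ 1ℚ

Norm≤1 : ∀ {k} → (Fin k → Pt k) → Pt k → Set
Norm≤1 b x = ∃ λ t → InUnitCoords t × toℚ x ≡ lincomb t b

InCube : ∀ {k} → (Fin k → Pt k) → Pt k → Vec ℚ _ → Set
InCube b a p = ∃ λ t → InUnitCoords t × p ≡ (toℚ a ⊕ℚ lincomb t b)

{-# OPTIONS --safe #-}
-- φ maps each edge of B_r + z to an edge, so it maps walks from z inside the
-- ball to walks of the same length from φ z: φ(B_r + z) ⊆ B_r + φ z, and
-- likewise for z′. If the cubes met, φ z + Σ tᵢbᵢ = φ z′ + Σ sᵢbᵢ with all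
-- tᵢ, sᵢ ∈ [−1,1], then choosing nᵢ ∈ {−1,0,1} with nᵢ + sᵢ − tᵢ ∈ [−1,1] gives
-- a lattice point y = φ z + Σ nᵢbᵢ with ‖y − φ z‖ ≤ 1 and ‖y − φ z′‖ ≤ 1, so
-- y ∈ (B_r + φ z) ∩ (B_r + φ z′). Then φ would inject the 2|B_r| points of the
-- disjoint balls around z, z′ into the fewer than 2|B_r| points of the
-- overlapping balls around φ z, φ z′.
module Submission where

open import Defs
open import Data.Nat using (ℕ; _≤_)
open import Data.Fin using (Fin)
open import Data.List.Membership.Propositional using (_∈_)
open import Data.Product using (∃; _×_)
open import Data.Sum using (_⊎_)
open import Relation.Binary.PropositionalEquality using (_≡_)
open import Relation.Nullary using (¬_)

open import Algebra.Bundles using (Group; AbelianGroup)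
open import Algebra.Core using (Op₁; Op₂)
open import Algebra.Structures using (IsAbelianGroup)
import Algebra.Properties.AbelianGroup as AbelianGroupProperties
import Algebra.Properties.Group as GroupProperties
open import Data.Fin using (zero; suc)
import Data.Fin.Properties as FinP
open import Data.Integer as ℤ using (ℤ; +_; -[1+_])
import Data.Integer.Properties as ℤP
open import Data.List as List using (List; []; _∷_; [_]; _++_; length)
import Data.List.Properties as ListP
open import Data.List.Membership.Propositional.Properties
open import Data.List.Relation.Unary.All as All using (All; []; _∷_)
open import Data.List.Relation.Unary.Any as Any using (here; there)
import Data.List.Relation.Unary.Any.Properties as AnyP
import Data.List.Membership.DecPropositional as DecMembership
open import Data.List.Relation.Unary.Unique.Propositional using (Unique)
import Data.List.Relation.Unary.Unique.Propositional.Properties as UniqueP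
import Data.List.Relation.Unary.Unique.DecPropositional.Properties as DecUniqueP
open import Data.List.Relation.Unary.AllPairs using (_∷_)
import Data.Nat as ℕ
import Data.Nat.Properties as ℕP
import Data.Nat.Coprimality as Coprimality
open import Data.Product using (_,_; proj₁; proj₂)
open import Data.Rational as ℚ using (ℚ; 0ℚ; 1ℚ; mkℚ; *≤*)
import Data.Rational.Properties as ℚP
open import Data.Rational.Solver using (module +-*-Solver)
open import Data.Sum as Sum using (inj₁; inj₂)
open import Data.Vec as Vec using (Vec)
import Data.Vec.Properties as VecP
open import Data.Empty using (⊥-elim)
open import Function using (_∘_; Injective)
open import Level using (0ℓ)
open import Relation.Binary.Definitions using (DecidableEquality)
open import Relation.Binary.PropositionalEquality
  using (refl; sym; trans; cong; cong₂; subst; subst₂; isEquivalence; module ≡-Reasoning)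
open import Relation.Nullary using (yes; no; ¬?)

vec-isAbelianGroup : ∀ {A : Set} {_+_ : Op₂ A} {0# : A} { -_ : Op₁ A} →
                     IsAbelianGroup _≡_ _+_ 0# -_ → ∀ n →
                     IsAbelianGroup _≡_ (Vec.zipWith {n = n} _+_) (Vec.replicate n 0#) (Vec.map -_)
vec-isAbelianGroup G n = record
  { isGroup = record
    { isMonoid = record
      { isSemigroup = record
        { isMagma = record { isEquivalence = isEquivalence ; ∙-cong = cong₂ _ }
        ; assoc = VecP.zipWith-assoc assoc
        }
      ; identity = VecP.zipWith-identityˡ identityˡ , VecP.zipWith-identityʳ identityʳ
      }
    ; inverse = VecP.zipWith-inverseˡ inverseˡ , VecP.zipWith-inverseʳ inverseʳ
    ; ⁻¹-cong = cong _
    }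
  ; comm = VecP.zipWith-comm comm
  }
  where open IsAbelianGroup G using (assoc; identityˡ; identityʳ; inverseˡ; inverseʳ; comm)

ℤᵏ : ℕ → AbelianGroup 0ℓ 0ℓ
ℤᵏ k = record
  { Carrier = Pt k ; _≈_ = _≡_ ; _∙_ = _⊕_ ; ε = 0v ; _⁻¹ = ⊖_
  ; isAbelianGroup = vec-isAbelianGroup ℤP.+-0-isAbelianGroup k
  }

ℚᵏ : ℕ → AbelianGroup 0ℓ 0ℓ
ℚᵏ k = record
  { Carrier = Vec ℚ k ; _≈_ = _≡_ ; _∙_ = _⊕ℚ_
  ; ε = Vec.replicate k 0ℚ ; _⁻¹ = Vec.map (ℚ.-_)
  ; isAbelianGroup = vec-isAbelianGroup ℚP.+-0-isAbelianGroup k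
  }

module _ {c ℓ} (G : Group c ℓ) where
  open Group G
  open GroupProperties G using (\\-leftDividesʳ)
  open import Relation.Binary.Reasoning.Setoid setoid

  //-telescope : ∀ x y z → (x // y) ∙ (y // z) ≈ x // z
  //-telescope x y z = begin
    (x // y) ∙ (y // z)      ≈⟨ assoc x (y ⁻¹) (y // z) ⟩
    x ∙ (y ⁻¹ ∙ (y ∙ z ⁻¹))  ≈⟨ ∙-congˡ (\\-leftDividesʳ y (z ⁻¹)) ⟩
    x // z                   ∎

module _ {c ℓ} (G : AbelianGroup c ℓ) where
  open AbelianGroup G
  open AbelianGroupProperties G using (xyx⁻¹≈y; x≈z//y)
  open import Relation.Binary.Reasoning.Setoid setoid

  x∙t≈x′∙s⇒x-x′≈s-t : ∀ {x x′ s t} → x ∙ t ≈ x′ ∙ s → x - x′ ≈ s - t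
  x∙t≈x′∙s⇒x-x′≈s-t {x} {x′} {s} {t} eq = x≈z//y (x - x′) t s (begin
    (x - x′) ∙ t       ≈⟨ assoc x (x′ ⁻¹) t ⟩
    x ∙ (x′ ⁻¹ ∙ t)    ≈⟨ ∙-congˡ (comm (x′ ⁻¹) t) ⟩
    x ∙ (t ∙ x′ ⁻¹)    ≈⟨ assoc x t (x′ ⁻¹) ⟨
    (x ∙ t) - x′       ≈⟨ ∙-congʳ eq ⟩
    (x′ ∙ s) - x′      ≈⟨ xyx⁻¹≈y x′ s ⟩
    s                  ∎)

fromℤ : ℤ → ℚ
fromℤ i = i ℚ./ 1

-- Exposing the normal form (denominator 1) lets ℚ's _+_ and _*_ compute on images of integers.
fromℤ≡mkℚ : ∀ i → fromℤ i ≡ mkℚ i 0 (Coprimality.sym (Coprimality.1-coprimeTo ℤ.∣ i ∣))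
fromℤ≡mkℚ (+ n)    = ℚP.normalize-coprime (Coprimality.sym (Coprimality.1-coprimeTo n))
fromℤ≡mkℚ -[1+ n ] =
  cong ℚ.-_ (ℚP.normalize-coprime (Coprimality.sym (Coprimality.1-coprimeTo (ℕ.suc n))))

fromℤ-homo-+ : ∀ i j → fromℤ (i ℤ.+ j) ≡ fromℤ i ℚ.+ fromℤ j
fromℤ-homo-+ i j rewrite fromℤ≡mkℚ i | fromℤ≡mkℚ j =
  cong fromℤ (cong₂ ℤ._+_ (sym (ℤP.*-identityʳ i)) (sym (ℤP.*-identityʳ j)))

fromℤ-homo-* : ∀ i j → fromℤ (i ℤ.* j) ≡ fromℤ i ℚ.* fromℤ j
fromℤ-homo-* i j rewrite fromℤ≡mkℚ i | fromℤ≡mkℚ j = refl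

fromℤ-homo‿- : ∀ i → fromℤ (ℤ.- i) ≡ ℚ.- fromℤ i
fromℤ-homo‿- (+ ℕ.zero)  = refl
fromℤ-homo‿- (+ ℕ.suc n) = refl
fromℤ-homo‿- -[1+ n ] rewrite fromℤ≡mkℚ (+ ℕ.suc n) = refl

toℚ-homo-⊕ : ∀ {k} (x y : Pt k) → toℚ (x ⊕ y) ≡ toℚ x ⊕ℚ toℚ y
toℚ-homo-⊕ Vec.[]      Vec.[]      = refl
toℚ-homo-⊕ (i Vec.∷ x) (j Vec.∷ y) = cong₂ Vec._∷_ (fromℤ-homo-+ i j) (toℚ-homo-⊕ x y)

toℚ-homo-⊖ : ∀ {k} (x : Pt k) → toℚ (⊖ x) ≡ Vec.map ℚ.-_ (toℚ x)
toℚ-homo-⊖ Vec.[]      = refl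
toℚ-homo-⊖ (i Vec.∷ x) = cong₂ Vec._∷_ (fromℤ-homo‿- i) (toℚ-homo-⊖ x)

Σℤ : ∀ {n} → (Fin n → ℤ) → ℤ
Σℤ {ℕ.zero}  f = + 0
Σℤ {ℕ.suc n} f = f zero ℤ.+ Σℤ (f ∘ suc)

fromℤ-Σ : ∀ {n} (f : Fin n → ℤ) → fromℤ (Σℤ f) ≡ Σℚ (fromℤ ∘ f)
fromℤ-Σ {ℕ.zero}  f = refl
fromℤ-Σ {ℕ.suc n} f =
  trans (fromℤ-homo-+ (f zero) (Σℤ (f ∘ suc))) (cong (fromℤ (f zero) ℚ.+_) (fromℤ-Σ (f ∘ suc)))

Σℚ-cong : ∀ {n} {f g : Fin n → ℚ} → (∀ i → f i ≡ g i) → Σℚ f ≡ Σℚ g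
Σℚ-cong {ℕ.zero}  eq = refl
Σℚ-cong {ℕ.suc n} eq = cong₂ ℚ._+_ (eq zero) (Σℚ-cong (eq ∘ suc))

Σℚ-+ : ∀ {n} (f g : Fin n → ℚ) → Σℚ (λ i → f i ℚ.+ g i) ≡ Σℚ f ℚ.+ Σℚ g
Σℚ-+ {ℕ.zero}  f g = refl
Σℚ-+ {ℕ.suc n} f g =
  trans (cong (f zero ℚ.+ g zero ℚ.+_) (Σℚ-+ (f ∘ suc) (g ∘ suc)))
        (interchange (f zero) (g zero) (Σℚ (f ∘ suc)) (Σℚ (g ∘ suc)))
  where
  open +-*-Solver
  interchange : ∀ a b c d → (a ℚ.+ b) ℚ.+ (c ℚ.+ d) ≡ (a ℚ.+ c) ℚ.+ (b ℚ.+ d)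
  interchange = solve 4 (λ a b c d → (a :+ b) :+ (c :+ d) := (a :+ c) :+ (b :+ d)) refl

zipWith-tabulate : ∀ {A B C : Set} {n} (_∙_ : A → B → C) (f : Fin n → A) (g : Fin n → B) →
                   Vec.zipWith _∙_ (Vec.tabulate f) (Vec.tabulate g) ≡ Vec.tabulate (λ j → f j ∙ g j)
zipWith-tabulate {n = ℕ.zero}  _∙_ f g = refl
zipWith-tabulate {n = ℕ.suc n} _∙_ f g =
  cong (f zero ∙ g zero Vec.∷_) (zipWith-tabulate _∙_ (f ∘ suc) (g ∘ suc))

lincomb-cong : ∀ {k} {c d : Fin k → ℚ} (b : Fin k → Pt k) →
               (∀ i → c i ≡ d i) → lincomb c b ≡ lincomb d b
lincomb-cong b eq = VecP.tabulate-cong λ j → Σℚ-cong λ i → cong (ℚ._* _) (eq i)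

lincomb-homo-+ : ∀ {k} (c d : Fin k → ℚ) (b : Fin k → Pt k) →
            lincomb (λ i → c i ℚ.+ d i) b ≡ lincomb c b ⊕ℚ lincomb d b
lincomb-homo-+ {k} c d b = trans
  (VecP.tabulate-cong λ j → trans (Σℚ-cong λ i → ℚP.*-distribʳ-+ (β j i) (c i) (d i))
                                  (Σℚ-+ (λ i → c i ℚ.* β j i) (λ i → d i ℚ.* β j i)))
  (sym (zipWith-tabulate ℚ._+_ _ _))
  where
  β : Fin k → Fin k → ℚ
  β j i = Vec.lookup (toℚ (b i)) j

lincombℤ : ∀ {k} → (Fin k → ℤ) → (Fin k → Pt k) → Pt k
lincombℤ n b = Vec.tabulate λ j → Σℤ λ i → n i ℤ.* Vec.lookup (b i) j

toℚ-lincombℤ : ∀ {k} (n : Fin k → ℤ) (b : Fin k → Pt k) →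
               toℚ (lincombℤ n b) ≡ lincomb (fromℤ ∘ n) b
toℚ-lincombℤ n b = trans (sym (VecP.tabulate-∘ fromℤ _)) (VecP.tabulate-cong λ j →
  trans (fromℤ-Σ (λ i → n i ℤ.* Vec.lookup (b i) j)) (Σℚ-cong λ i →
    trans (fromℤ-homo-* (n i) (Vec.lookup (b i) j))
          (cong (fromℤ (n i) ℚ.*_) (sym (VecP.lookup-map j fromℤ (b i))))))

lincomb-homo-minus : ∀ {k} (s t : Fin k → ℚ) (b : Fin k → Pt k) →
            lincomb (λ i → s i ℚ.- t i) b ≡ AbelianGroup._-_ (ℚᵏ k) (lincomb s b) (lincomb t b)
lincomb-homo-minus {k} s t b = x≈z//y _ _ _
  (trans (sym (lincomb-homo-+ (λ i → s i ℚ.- t i) t b)) (lincomb-cong b λ i → //-rightDividesˡ (t i) (s i)))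
  where
  open AbelianGroupProperties (ℚᵏ k) using (x≈z//y)
  open GroupProperties ℚP.+-0-group using (//-rightDividesˡ)

InUnit : ℚ → Set
InUnit q = ℚ.- 1ℚ ℚ.≤ q × q ℚ.≤ 1ℚ

integerShift-into-unit : ∀ {s t} → InUnit s → InUnit t →
                         ∃ λ n → InUnit (fromℤ n) × InUnit (fromℤ n ℚ.+ (s ℚ.- t))
integerShift-into-unit {s} {t} (-1≤s , s≤1) (-1≤t , t≤1)
  with 1ℚ ℚP.<? s ℚ.- t | s ℚ.- t ℚP.<? ℚ.- 1ℚ
... | yes 1<s-t | _ = -[1+ 0 ] , (ℚP.≤-refl , *≤* ℤ.-≤+) ,
       (ℚP.+-monoʳ-≤ (ℚ.- 1ℚ) 0≤s-t , ℚP.+-monoʳ-≤ (ℚ.- 1ℚ) s-t≤2)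
  where
  0≤s-t : 0ℚ ℚ.≤ s ℚ.- t
  0≤s-t = ℚP.≤-trans (*≤* (ℤ.+≤+ ℕ.z≤n)) (ℚP.<⇒≤ 1<s-t)
  s-t≤2 : s ℚ.- t ℚ.≤ 1ℚ ℚ.+ 1ℚ
  s-t≤2 = ℚP.+-mono-≤ s≤1 (ℚP.neg-antimono-≤ -1≤t)
... | no _ | yes s-t<-1 = + 1 , (*≤* ℤ.-≤+ , ℚP.≤-refl) ,
       (ℚP.+-monoʳ-≤ 1ℚ -2≤s-t ,
        ℚP.≤-trans (ℚP.+-monoʳ-≤ 1ℚ (ℚP.<⇒≤ s-t<-1)) (*≤* (ℤ.+≤+ ℕ.z≤n)))
  where
  -2≤s-t : ℚ.- 1ℚ ℚ.+ ℚ.- 1ℚ ℚ.≤ s ℚ.- t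
  -2≤s-t = ℚP.+-mono-≤ -1≤s (ℚP.neg-antimono-≤ t≤1)
... | no s-t≯1 | no s-t≮-1 = + 0 , (*≤* ℤ.-≤+ , *≤* (ℤ.+≤+ ℕ.z≤n)) ,
       (ℚP.≤-trans (ℚP.≮⇒≥ s-t≮-1) (ℚP.≤-reflexive (sym (ℚP.+-identityˡ _))) ,
        ℚP.≤-trans (ℚP.≤-reflexive (ℚP.+-identityˡ _)) (ℚP.≮⇒≥ s-t≯1))

cubes-meet⇒lattice-point : ∀ {k} (b : Fin k → Pt k) {a a′ : Pt k} {p} →
                           InCube b a p → InCube b a′ p →
                           ∃ λ y → Norm≤1 b (y ⊝ a) × Norm≤1 b (y ⊝ a′)
cubes-meet⇒lattice-point {k} b {a} {a′} (t , t∈ , p≡a+t) (s , s∈ , p≡a′+s) =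
  y , (fromℤ ∘ n , proj₁ ∘ n∈ , y-a≡n) , (c , proj₂ ∘ n∈ , y-a′≡c)
  where
  open AbelianGroup (ℚᵏ k) using (_∙_; _-_; _⁻¹; assoc)
  open AbelianGroupProperties (ℤᵏ k) using (//-rightDividesʳ)
  shift : ∀ i → ∃ λ m → InUnit (fromℤ m) × InUnit (fromℤ m ℚ.+ (s i ℚ.- t i))
  shift i = integerShift-into-unit (s∈ i) (t∈ i)
  n : Fin k → ℤ
  n = proj₁ ∘ shift
  n∈ : ∀ i → InUnit (fromℤ (n i)) × InUnit (fromℤ (n i) ℚ.+ (s i ℚ.- t i))
  n∈ = proj₂ ∘ shift
  c : Fin k → ℚ
  c i = fromℤ (n i) ℚ.+ (s i ℚ.- t i)
  y : Pt k
  y = lincombℤ n b ⊕ a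
  y-a≡n : toℚ (y ⊝ a) ≡ lincomb (fromℤ ∘ n) b
  y-a≡n = trans (cong toℚ (//-rightDividesʳ a (lincombℤ n b))) (toℚ-lincombℤ n b)
  N : Vec ℚ k
  N = lincomb (fromℤ ∘ n) b
  y-a′≡c : toℚ (y ⊝ a′) ≡ lincomb c b
  y-a′≡c = begin
    toℚ (y ⊝ a′)
      ≡⟨ trans (toℚ-homo-⊕ y (⊖ a′)) (cong₂ _∙_ (toℚ-homo-⊕ (lincombℤ n b) a) (toℚ-homo-⊖ a′)) ⟩
    (toℚ (lincombℤ n b) ∙ toℚ a) - toℚ a′
      ≡⟨ cong (λ v → (v ∙ toℚ a) - toℚ a′) (toℚ-lincombℤ n b) ⟩
    (N ∙ toℚ a) - toℚ a′
      ≡⟨ assoc N (toℚ a) (toℚ a′ ⁻¹) ⟩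
    N ∙ (toℚ a - toℚ a′)
      ≡⟨ cong (N ∙_) (x∙t≈x′∙s⇒x-x′≈s-t (ℚᵏ k) (trans (sym p≡a+t) p≡a′+s)) ⟩
    N ∙ (lincomb s b - lincomb t b)
      ≡⟨ cong (N ∙_) (lincomb-homo-minus s t b) ⟨
    N ∙ lincomb (λ i → s i ℚ.- t i) b
      ≡⟨ lincomb-homo-+ (fromℤ ∘ n) (λ i → s i ℚ.- t i) b ⟨
    lincomb c b
      ∎
    where open ≡-Reasoning

Unique⇒lookup-injective : ∀ {X : Set} {xs : List X} → Unique xs → Injective _≡_ _≡_ (List.lookup xs)
Unique⇒lookup-injective (_ ∷ _)   {zero}  {zero}  _  = refl
Unique⇒lookup-injective (x∉ ∷ _)  {zero}  {suc j} eq = ⊥-elim (All.lookup x∉ (∈-lookup j) eq)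
Unique⇒lookup-injective (x∉ ∷ _)  {suc i} {zero}  eq = ⊥-elim (All.lookup x∉ (∈-lookup i) (sym eq))
Unique⇒lookup-injective (_ ∷ xs!) {suc i} {suc j} eq = cong suc (Unique⇒lookup-injective xs! eq)

injectsInto⇒length-≤ : ∀ {X Y : Set} {xs : List X} {ys : List Y} (f : X → Y) → Unique xs →
                       (∀ {x} → x ∈ xs → f x ∈ ys) →
                       (∀ {x x′} → x ∈ xs → x′ ∈ xs → f x ≡ f x′ → x ≡ x′) →
                       length xs ≤ length ys
injectsInto⇒length-≤ {xs = xs} {ys} f xs! into injective = FinP.injective⇒≤ index-injective
  where
  index : Fin (length xs) → Fin (length ys)
  index i = Any.index (into (∈-lookup i))
  index-injective : Injective _≡_ _≡_ index
  index-injective {i} {j} eq = Unique⇒lookup-injective xs! (injective (∈-lookup i) (∈-lookup j)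
    (trans (AnyP.lookup-index (into (∈-lookup i)))
      (trans (cong (List.lookup ys) eq) (sym (AnyP.lookup-index (into (∈-lookup j)))))))

common⇒short-union : ∀ {X : Set} → DecidableEquality X → (xs ys : List X) {w : X} → w ∈ xs → w ∈ ys →
                     ∃ λ zs → length zs ℕ.< length (xs ++ ys) × (∀ {v} → v ∈ xs ⊎ v ∈ ys → v ∈ zs)
common⇒short-union {X} _≟_ xs ys w∈xs w∈ys = xs ++ ys∖xs , shorter , covers
  where
  open DecMembership _≟_ using (_∈?_)
  ys∖xs : List X
  ys∖xs = List.filter (λ v → ¬? (v ∈? xs)) ys
  shorter : length (xs ++ ys∖xs) ℕ.< length (xs ++ ys)
  shorter = subst₂ ℕ._<_ (sym (ListP.length-++ xs)) (sym (ListP.length-++ xs))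
    (ℕP.+-monoʳ-< (length xs) (ListP.filter-notAll _ ys (Any.map (λ { refl w∉xs → w∉xs w∈xs }) w∈ys)))
  covers : ∀ {v} → v ∈ xs ⊎ v ∈ ys → v ∈ xs ++ ys∖xs
  covers (inj₁ v∈xs) = ∈-++⁺ˡ v∈xs
  covers {v} (inj₂ v∈ys) with v ∈? xs
  ... | yes v∈xs = ∈-++⁺ˡ v∈xs
  ... | no v∉xs  = ∈-++⁺ʳ xs (∈-filter⁺ _ v∈ys v∉xs)

module Balls {k} (A : List (Pt k)) where

  open AbelianGroup (ℤᵏ k) using (assoc; identityˡ; inverseʳ; group)
  open AbelianGroupProperties (ℤᵏ k) using (//-rightDividesˡ; //-rightDividesʳ; ∙-cancelʳ)

  _≟_ : DecidableEquality (Pt k)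
  _≟_ = VecP.≡-dec ℤP._≟_

  walk-∷ : ∀ {a x n} → a ∈ A → Walk A x n → Walk A (a ⊕ x) (ℕ.suc n)
  walk-∷ a∈A (l , l⊆A , refl , refl) = _ ∷ l , a∈A ∷ l⊆A , refl , refl

  walksUpTo : ℕ → List (List (Pt k))
  walksUpTo ℕ.zero    = [ [] ]
  walksUpTo (ℕ.suc r) = [] ∷ List.cartesianProductWith _∷_ A (walksUpTo r)

  ∈-walksUpTo⁺ : ∀ {r l} → All (_∈ A) l → length l ≤ r → l ∈ walksUpTo r
  ∈-walksUpTo⁺ {ℕ.zero}  []          _              = here refl
  ∈-walksUpTo⁺ {ℕ.suc r} []          _              = here refl
  ∈-walksUpTo⁺ {ℕ.suc r} (a∈A ∷ l⊆A) (ℕ.s≤s len≤r) =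
    there (∈-cartesianProductWith⁺ _∷_ a∈A (∈-walksUpTo⁺ l⊆A len≤r))

  ∈-walksUpTo⁻ : ∀ r {l} → l ∈ walksUpTo r → All (_∈ A) l × length l ≤ r
  ∈-walksUpTo⁻ ℕ.zero    (here refl) = [] , ℕ.z≤n
  ∈-walksUpTo⁻ (ℕ.suc r) (here refl) = [] , ℕ.z≤n
  ∈-walksUpTo⁻ (ℕ.suc r) (there l∈)
    with _ , _ , a∈A , w∈ , refl ← ∈-cartesianProductWith⁻ _∷_ A (walksUpTo r) l∈
    with w⊆A , len≤r ← ∈-walksUpTo⁻ r w∈ = a∈A ∷ w⊆A , ℕ.s≤s len≤r

  ballList : ℕ → List (Pt k)
  ballList r = List.deduplicate _≟_ (List.map sumV (walksUpTo r))

  ∈-ballList⁺ : ∀ {r x} → ρ≤ A x r → x ∈ ballList r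
  ∈-ballList⁺ (_ , n≤r , l , l⊆A , refl , refl) =
    ∈-deduplicate⁺ _≟_ (∈-map⁺ sumV (∈-walksUpTo⁺ l⊆A n≤r))

  ∈-ballList⁻ : ∀ {r x} → x ∈ ballList r → ρ≤ A x r
  ∈-ballList⁻ {r} x∈
    with l , l∈ , refl ← ∈-map⁻ sumV (∈-deduplicate⁻ _≟_ (List.map sumV (walksUpTo r)) x∈)
    with l⊆A , len≤r ← ∈-walksUpTo⁻ r l∈ = length l , len≤r , l , l⊆A , refl , refl

  ballAt : ℕ → Pt k → List (Pt k)
  ballAt r c = List.map (_⊕ c) (ballList r)

  ∈-ballAt⁺ : ∀ {r c q} → InBall A r c q → q ∈ ballAt r c
  ∈-ballAt⁺ {c = c} {q} q∈B = subst (_∈ _) (//-rightDividesˡ c q) (∈-map⁺ (_⊕ c) (∈-ballList⁺ q∈B))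

  ∈-ballAt⁻ : ∀ {r c q} → q ∈ ballAt r c → InBall A r c q
  ∈-ballAt⁻ {r} {c} q∈ with x , x∈ , refl ← ∈-map⁻ (_⊕ c) q∈ =
    subst (λ v → ρ≤ A v r) (sym (//-rightDividesʳ c x)) (∈-ballList⁻ x∈)

  ballAt-unique : ∀ r c → Unique (ballAt r c)
  ballAt-unique r c = UniqueP.map⁺ (∙-cancelʳ c _ _) (DecUniqueP.deduplicate-! _≟_ _)

  ballPair : ℕ → Pt k → Pt k → List (Pt k)
  ballPair r c c′ = ballAt r c ++ ballAt r c′

  length-ballPair : ∀ r c c′ → length (ballPair r c c′) ≡ length (ballList r) ℕ.+ length (ballList r)
  length-ballPair r c c′ =
    trans (ListP.length-++ (ballAt r c))
          (cong₂ ℕ._+_ (ListP.length-map _ (ballList r)) (ListP.length-map _ (ballList r)))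

  ∈-ballPair⁻ : ∀ {r c c′ q} → q ∈ ballPair r c c′ → InBall A r c q ⊎ InBall A r c′ q
  ∈-ballPair⁻ {r} {c} q∈ = Sum.map ∈-ballAt⁻ ∈-ballAt⁻ (∈-++⁻ (ballAt r c) q∈)

  ballPair-unique : ∀ {r c c′} → (∀ v → InBall A r c v → ¬ InBall A r c′ v) → Unique (ballPair r c c′)
  ballPair-unique {r} {c} {c′} disjoint =
    UniqueP.++⁺ (ballAt-unique r c) (ballAt-unique r c′)
      λ (v∈ , v∈′) → disjoint _ (∈-ballAt⁻ v∈) (∈-ballAt⁻ v∈′)

  overlapping-ballPair-cover : ∀ {r c c′ y} → InBall A r c y → InBall A r c′ y →
                               ∃ λ zs → length zs ℕ.< length (ballPair r c c′)
                                      × (∀ {v} → InBall A r c v ⊎ InBall A r c′ v → v ∈ zs)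
  overlapping-ballPair-cover {r} {c} {c′} y∈B y∈B′
    with zs , shorter , covers ←
           common⇒short-union _≟_ (ballAt r c) (ballAt r c′) (∈-ballAt⁺ y∈B) (∈-ballAt⁺ y∈B′)
    = zs , shorter , covers ∘ Sum.map ∈-ballAt⁺ ∈-ballAt⁺

  module _ {r : ℕ} {z : Pt k} {φ : Pt k → Pt k}
           (φ-edge : ∀ u v → InBall A r z u → InBall A r z v → (v ⊝ u) ∈ A → (φ v ⊝ φ u) ∈ A) where

    walk⇒InBall : ∀ {l} → All (_∈ A) l → length l ≤ r → InBall A r z (sumV l ⊕ z)
    walk⇒InBall {l} l⊆A len≤r = length l , len≤r , l , l⊆A , refl , sym (//-rightDividesʳ z (sumV l))

    walk-image : ∀ {l} → All (_∈ A) l → length l ≤ r → Walk A (φ (sumV l ⊕ z) ⊝ φ z) (length l)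
    walk-image [] _ =
      [] , [] , refl , sym (trans (cong (λ v → φ v ⊝ φ z) (identityˡ z)) (inverseʳ (φ z)))
    walk-image {a ∷ l} (a∈A ∷ l⊆A) len≤r =
      subst (λ x → Walk A x (length (a ∷ l))) (//-telescope group (φ v) (φ u) (φ z))
        (walk-∷ edge (walk-image l⊆A len′≤r))
      where
      len′≤r : length l ≤ r
      len′≤r = ℕP.≤-trans (ℕP.n≤1+n _) len≤r
      u v : Pt k
      u = sumV l ⊕ z
      v = (a ⊕ sumV l) ⊕ z
      v-u≡a : v ⊝ u ≡ a
      v-u≡a = trans (cong (_⊝ u) (assoc a (sumV l) z)) (//-rightDividesʳ u a)
      edge : (φ v ⊝ φ u) ∈ A
      edge = φ-edge u v (walk⇒InBall l⊆A len′≤r) (walk⇒InBall (a∈A ∷ l⊆A) len≤r)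
               (subst (_∈ A) (sym v-u≡a) a∈A)

    ball-image : ∀ {q} → InBall A r z q → InBall A r (φ z) (φ q)
    ball-image {q} (_ , n≤r , l , l⊆A , refl , l-sum) = length l , n≤r ,
      subst (λ w → Walk A (φ w ⊝ φ z) (length l)) (trans (cong (_⊕ z) l-sum) (//-rightDividesˡ z q))
        (walk-image l⊆A n≤r)

proposition13 : (k : ℕ) → 1 ≤ k → (S : GenSet k) →
  (b : Fin k → Pt k) → IsBasis b →
  (∀ i → Primary (GenSet.A S) (b i)) →
  (∀ x → Primary (GenSet.A S) x → Norm≤1 b x) →
  (r : ℕ) → (∀ x → Norm≤1 b x → ρ≤ (GenSet.A S) x r) →
  (z z' : Pt k) →
  (∀ v → InBall (GenSet.A S) r z v → ¬ InBall (GenSet.A S) r z' v) →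
  (φ : Pt k → Pt k) →
  (∀ u v → (InBall (GenSet.A S) r z u ⊎ InBall (GenSet.A S) r z' u) →
           (InBall (GenSet.A S) r z v ⊎ InBall (GenSet.A S) r z' v) →
           φ u ≡ φ v → u ≡ v) →
  (∀ u v → ((InBall (GenSet.A S) r z u × InBall (GenSet.A S) r z v)
            ⊎ (InBall (GenSet.A S) r z' u × InBall (GenSet.A S) r z' v)) →
           (v ⊝ u) ∈ GenSet.A S → (φ v ⊝ φ u) ∈ GenSet.A S) →
  ¬ (∃ λ p → InCube b (φ z) p × InCube b (φ z') p)
proposition13 k _ S b _ _ _ r unitCube⊆B_r z z′ disjoint φ φ-injective φ-edge (p , p∈S₁+φz , p∈S₁+φz′)
  with y , y-φz∈S₁ , y-φz′∈S₁ ← cubes-meet⇒lattice-point b p∈S₁+φz p∈S₁+φz′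
  with zs , zs-shorter , covers ← Balls.overlapping-ballPair-cover (GenSet.A S)
                                    (unitCube⊆B_r _ y-φz∈S₁) (unitCube⊆B_r _ y-φz′∈S₁)
  = ℕP.<-irrefl refl (begin-strict
    N ℕ.+ N                           ≡⟨ length-ballPair r z z′ ⟨
    length (ballPair r z z′)          ≤⟨ injectsInto⇒length-≤ φ (ballPair-unique disjoint) (covers ∘ φ-image)
                                           (λ u∈ v∈ → φ-injective _ _ (∈-ballPair⁻ u∈) (∈-ballPair⁻ v∈)) ⟩
    length zs                         <⟨ zs-shorter ⟩
    length (ballPair r (φ z) (φ z′))  ≡⟨ length-ballPair r (φ z) (φ z′) ⟩
    N ℕ.+ N                           ∎)
  where
  open Balls (GenSet.A S)
  open ℕP.≤-Reasoning
  N : ℕ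
  N = length (ballList r)
  φ-image : ∀ {q} → q ∈ ballPair r z z′ →
            InBall (GenSet.A S) r (φ z) (φ q) ⊎ InBall (GenSet.A S) r (φ z′) (φ q)
  φ-image = Sum.map (ball-image (λ u v u∈ v∈ → φ-edge u v (inj₁ (u∈ , v∈))))
                    (ball-image (λ u v u∈ v∈ → φ-edge u v (inj₂ (u∈ , v∈)))) ∘ ∈-ballPair⁻
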